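{- Let $h\geq 1$ be an integer and let $\rho\geq 3$ be an odd integer. There exists a sequence $\mathcal{F}=\mathcal{F}_{h,\rho}$ consisting of blocks of size $2\times 6$ such that (1) $\mathcal{F}$ has cardinality $h$ and satisfies Condition (C); (2) $\operatorname{supp}(\mathcal{F})=\left[1,12h+\left\lfloor\frac{12h}{\rho-1}\right\rfloor\right]\setminus\left\{\rho,2\rho,\ldots,\left\lfloor\frac{12h}{\rho-1}\right\rfloor\rho\right\}$.
   Context: For integers $a\leq b$, $[a,b]=\{a,a+1,\ldots,b\}$. A block is a (fully filled) array with integer entries; it is shiftable if every row and every column contains an equal number of positive and negative entries. For a sequence $\mathcal{B}$ of blocks, $\operatorname{supp}(\mathcal{B})$ is the set of absolute values of all entries of all blocks in $\mathcal{B}$. A sequence $\mathcal{B}$ of blocks satisfies Condition (C) if there exist integers $\sigma_1,\ldots,\sigma_b$ (the same for all blocks of the sequence) such that every element $B$ of $\mathcal{B}$ is a shiftable block of size $2\times 2b$ whose two rows each sum to $0$ and whose columns satisfy: the $(2i-1)$-th column sums to $\sigma_i$ and the $2i$-th column sums to $-\sigma_i$, for all $i\in[1,b]$. -}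

module Defs where

open import Data.Nat as ℕ using (ℕ; zero; suc; _*_)
open import Data.Nat.DivMod using (_/_)
open import Data.Integer as ℤ using (ℤ; 0ℤ; -_; ∣_∣)
open import Data.Integer.Properties using (_<?_)
open import Data.Fin using (Fin; zero; suc; toℕ)
open import Data.List using (List; filter; length; allFin)
open import Data.Vec using (Vec; lookup)
open import Data.Product using (Σ; ∃; _×_)
open import Relation.Binary.PropositionalEquality using (_≡_)

Σℤ : (n : ℕ) → (Fin n → ℤ) → ℤ
Σℤ zero    f = 0ℤ
Σℤ (suc n) f = f zero ℤ.+ Σℤ n (λ i → f (suc i))

#pos : (n : ℕ) → (Fin n → ℤ) → ℕ
#pos n f = length (filter (λ i → 0ℤ <? f i) (allFin n))

#neg : (n : ℕ) → (Fin n → ℤ) → ℕ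
#neg n f = length (filter (λ i → f i <? 0ℤ) (allFin n))

Block : ℕ → ℕ → Set
Block m n = Fin m → Fin n → ℤ

Shiftable : {m n : ℕ} → Block m n → Set
Shiftable {m} {n} B =
  (∀ r → #pos n (B r) ≡ #neg n (B r)) ×
  (∀ c → #pos m (λ r → B r c) ≡ #neg m (λ r → B r c))

CondCBlock : (b : ℕ) → (Fin b → ℤ) → Block 2 (2 * b) → Set
CondCBlock b σ B =
  Shiftable B ×
  (∀ r → Σℤ (2 * b) (B r) ≡ 0ℤ) ×
  -- 0-based column c with c = 2i is the paper's column 2i-1 (1-based, i ∈ [1,b] shifted)
  (∀ (i : Fin b) (c : Fin (2 * b)) → toℕ c ≡ 2 * toℕ i → Σℤ 2 (λ r → B r c) ≡ σ i) ×
  (∀ (i : Fin b) (c : Fin (2 * b)) → toℕ c ≡ suc (2 * toℕ i) → Σℤ 2 (λ r → B r c) ≡ - σ i)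

ConditionC : (b : ℕ) {h : ℕ} → Vec (Block 2 (2 * b)) h → Set
ConditionC b {h} 𝓑 = Σ (Fin b → ℤ) λ σ → ∀ k → CondCBlock b σ (lookup 𝓑 k)

InSupp : {m n h : ℕ} → Vec (Block m n) h → ℕ → Set
InSupp 𝓑 x = ∃ λ k → ∃ λ r → ∃ λ c → ∣ lookup 𝓑 k r c ∣ ≡ x

-- floor division a / d, with the convention a / 0 = 0 (only used for d ≥ 2)
⌊_/_⌋ : ℕ → ℕ → ℕ
⌊ a / zero ⌋  = 0
⌊ a / suc d ⌋ = a / suc d

module Submission where

-- Write L = ρ - 1. The support to be produced consists of the first 12h positive
-- integers that are not multiples of L + 1, and the t-th of them (counting from 0) is
-- 1 + skip t with skip t = t + ⌊t/L⌋. Block k receives the twelve numbers with indices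
-- 12k, ..., 12k + 11. As L is even, skip increases by 1 after every even index, so these
-- numbers come in pairs (y, y + 1), and consecutive pairs are 2 apart, or 3 apart when
-- L divides the index of the second one. For ρ = 3 every gap is 3; for ρ ≥ 5 a block has
-- at most one gap 3, except that gaps before the indices 4 and 8 may both be 3. For each
-- of the five resulting gap patterns a fixed signed 2 × 6 arrangement (a template) has
-- zero row sums and column sums ±1, ±2, ±2 (±1, ±2, ±4 for ρ = 3), whatever the pairs are.

open import Defs
open import Data.Integer using (ℤ; +_; -_; 0ℤ; _◃_; ∣_∣)
open import Data.Integer.Properties using (+◃n≡+n; -◃n≡-n; abs-◃)
open import Data.Sign as Sign using (Sign)
open import Data.Fin using (Fin; zero; suc; toℕ; fromℕ<; #_; _≟_)
open import Data.Fin.Properties using (toℕ<n; toℕ-fromℕ<; toℕ-injective; any?; all?)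
open import Data.Vec using (Vec; []; _∷_; lookup; tabulate)
open import Data.Vec.Properties using (lookup∘tabulate)
open import Data.Product using (Σ; ∃; _×_; _,_)
open import Data.Sum using (inj₁; inj₂)
open import Data.Empty using (⊥-elim)
open import Function.Base using (_∘′_)
open import Function.Bundles using (_⇔_; mk⇔)
open import Function.Construct.Composition using (_⇔-∘_)
open import Relation.Nullary using (¬_; Dec)
open import Relation.Nullary.Decidable using (yes; no; from-yes; from-no)
open import Relation.Binary.PropositionalEquality

-- The row and column sums of the blocks built below unfold to exactly these shapes. They
-- precede the import of ℕ's _+_, which would clash with ℤ's.
module IntegerIdentities where
  open import Data.Integer using (_+_)
  open import Data.Integer.Tactic.RingSolver using (solve-∀)

  column-top⁺ : ∀ d n → + 1 + (d + n) + (- (+ 1 + n) + 0ℤ) ≡ d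
  column-top⁺ = solve-∀

  column-top⁻ : ∀ d n → - (+ 1 + (d + n)) + (+ 1 + n + 0ℤ) ≡ - d
  column-top⁻ = solve-∀

  column-bottom⁺ : ∀ d m → + 1 + m + (- (+ 1 + (d + m)) + 0ℤ) ≡ - d
  column-bottom⁺ = solve-∀

  column-bottom⁻ : ∀ d m → - (+ 1 + m) + (+ 1 + (d + m) + 0ℤ) ≡ d
  column-bottom⁻ = solve-∀

  T₄₈-row₀ : ∀ a b c → + 2 + a + (- (+ 4 + a) + (- (+ 1 + b) + (+ 2 + b + (- (+ 1 + c) + (+ 2 + c + 0ℤ))))) ≡ 0ℤ
  T₄₈-row₀ = solve-∀

  T₄₈-row₁ : ∀ a b c → - (+ 1 + a) + (+ 3 + a + (+ 3 + b + (- (+ 4 + b) + (+ 3 + c + (- (+ 4 + c) + 0ℤ))))) ≡ 0ℤ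
  T₄₈-row₁ = solve-∀

  T₂-row₀ : ∀ a b → + 2 + a + (+ 8 + a + (- (+ 4 + a) + (- (+ 7 + a) + (- (+ 1 + b) + (+ 2 + b + 0ℤ))))) ≡ 0ℤ
  T₂-row₀ = solve-∀

  T₂-row₁ : ∀ a b → - (+ 1 + a) + (- (+ 9 + a) + (+ 6 + a + (+ 5 + a + (+ 3 + b + (- (+ 4 + b) + 0ℤ))))) ≡ 0ℤ
  T₂-row₁ = solve-∀

  T₆-row₀ : ∀ a → + 2 + a + (+ 8 + a + (- (+ 3 + a) + (- (+ 6 + a) + (+ 12 + a + (- (+ 13 + a) + 0ℤ))))) ≡ 0ℤ
  T₆-row₀ = solve-∀

  T₆-row₁ : ∀ a → - (+ 1 + a) + (- (+ 9 + a) + (+ 5 + a + (+ 4 + a + (- (+ 10 + a) + (+ 11 + a + 0ℤ))))) ≡ 0ℤ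
  T₆-row₁ = solve-∀

  T₁₀-row₀ : ∀ a b → + 2 + b + (+ 8 + b + (+ 3 + a + (- (+ 4 + a) + (- (+ 3 + b) + (- (+ 6 + b) + 0ℤ))))) ≡ 0ℤ
  T₁₀-row₀ = solve-∀

  T₁₀-row₁ : ∀ a b → - (+ 1 + b) + (- (+ 9 + b) + (- (+ 1 + a) + (+ 2 + a + (+ 5 + b + (+ 4 + b + 0ℤ))))) ≡ 0ℤ
  T₁₀-row₁ = solve-∀

  Tₐₗₗ-row₀ : ∀ a → + 2 + a + (+ 10 + a + (- (+ 5 + a) + (- (+ 16 + a) + (- (+ 4 + a) + (+ 13 + a + 0ℤ))))) ≡ 0ℤ
  Tₐₗₗ-row₀ = solve-∀

  Tₐₗₗ-row₁ : ∀ a → - (+ 1 + a) + (- (+ 11 + a) + (+ 7 + a + (+ 14 + a + (+ 8 + a + (- (+ 17 + a) + 0ℤ))))) ≡ 0ℤ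
  Tₐₗₗ-row₁ = solve-∀

open IntegerIdentities

open import Data.Nat using (ℕ; zero; suc; _+_; _*_; _≤_; _<_; _%_; _∸_; _/_; NonZero; z≤n; s≤s; s≤s⁻¹)
open import Data.Nat.Properties
  using (module ≤-Reasoning; n<1+n; m≤m+n; +-comm; +-assoc; +-suc; *-suc; *-comm; <⇒≤; <⇒≱; ≰⇒>; ≮⇒≥; m≤n⇒m<n∨m≡n; <-≤-trans
        ; +-mono-≤; +-mono-<; +-monoˡ-<; *-monoˡ-≤; *-monoʳ-≤; *-monoʳ-<; suc-injective)
open import Data.Nat.DivMod
  using (m≡m%n+[m/n]*n; m%n<n; m<n⇒m/n≡0; m*n/n≡m; +-distrib-/-∣ʳ; /-monoˡ-≤; m<n*o⇒m/o<n)
open import Data.Nat.Divisibility using (_∣_; _∣?_; divides; ∣-refl; ∣-trans; n∣m*n; ∣m∣n⇒∣m+n; ∣m+n∣m⇒∣n; ∣⇒≤)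

∣m+n∣n⇒∣m : ∀ {d m n} → d ∣ m + n → d ∣ n → d ∣ m
∣m+n∣n⇒∣m {d} {m} {n} d∣m+n = ∣m+n∣m⇒∣n (subst (d ∣_) (+-comm m n) d∣m+n)

∣8⇒4∣ : ∀ {d} → 2 < d → d ∣ 8 → 4 ∣ d
∣8⇒4∣ {1} (s≤s ()) _
∣8⇒4∣ {2} (s≤s (s≤s ())) _
∣8⇒4∣ {3} _ 3∣8 = ⊥-elim (from-no (3 ∣? 8) 3∣8)
∣8⇒4∣ {4} _ _   = ∣-refl
∣8⇒4∣ {5} _ 5∣8 = ⊥-elim (from-no (5 ∣? 8) 5∣8)
∣8⇒4∣ {6} _ 6∣8 = ⊥-elim (from-no (6 ∣? 8) 6∣8)
∣8⇒4∣ {7} _ 7∣8 = ⊥-elim (from-no (7 ∣? 8) 7∣8)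
∣8⇒4∣ {8} _ _   = divides 2 refl
∣8⇒4∣ {suc (suc (suc (suc (suc (suc (suc (suc (suc d))))))))} _ d∣8 = ⊥-elim (<⇒≱ (m≤m+n 9 d) (∣⇒≤ d∣8))

4∣m⇒4∤2+m : ∀ {m} → 4 ∣ m → ¬ 4 ∣ 2 + m
4∣m⇒4∤2+m 4∣m 4∣2+m = from-no (4 ∣? 2) (∣m+n∣n⇒∣m 4∣2+m 4∣m)

[e+k*n]<h*n : ∀ {e k n h} → e < n → k < h → e + k * n < h * n
[e+k*n]<h*n {k = k} {n} e<n k<h = <-≤-trans (+-monoˡ-< (k * n) e<n) (*-monoˡ-≤ n k<h)

2∣k*12 : ∀ k → 2 ∣ k * 12
2∣k*12 k = ∣-trans (divides 6 refl) (n∣m*n k)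

4∣k*12 : ∀ k → 4 ∣ k * 12
4∣k*12 k = ∣-trans (divides 3 refl) (n∣m*n k)

odd⇒2∣pred : ∀ m → suc m % 2 ≡ 1 → 2 ∣ m
odd⇒2∣pred m odd = divides (suc m / 2) (suc-injective (trans (m≡m%n+[m/n]*n (suc m) 2) (cong (_+ suc m / 2 * 2) odd)))

module Skipping (L : ℕ) .{{_ : NonZero L}} where

  skip : ℕ → ℕ
  skip t = t + t / L

  [s+q*L]/L≡q : ∀ q {s} → s < L → (s + q * L) / L ≡ q
  [s+q*L]/L≡q q {s} s<L = begin
    (s + q * L) / L     ≡⟨ +-distrib-/-∣ʳ s (n∣m*n q) ⟩
    s / L + q * L / L   ≡⟨ cong₂ _+_ (m<n⇒m/n≡0 s<L) (m*n/n≡m q L) ⟩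
    q                   ∎
    where open ≡-Reasoning

  skip-euclid : ∀ q {s} → s < L → skip (s + q * L) ≡ s + q * suc L
  skip-euclid q {s} s<L = begin
    s + q * L + (s + q * L) / L  ≡⟨ cong (_+_ (s + q * L)) ([s+q*L]/L≡q q s<L) ⟩
    s + q * L + q                ≡⟨ +-assoc s (q * L) q ⟩
    s + (q * L + q)              ≡⟨ cong (_+_ s) (trans (+-comm (q * L) q) (sym (*-suc q L))) ⟩
    s + q * suc L                ∎
    where open ≡-Reasoning

  suc-euclid : ∀ t → suc t ≡ suc (t % L) + t / L * L
  suc-euclid t = cong suc (m≡m%n+[m/n]*n t L)

  /-suc-∤ : ∀ t → ¬ L ∣ suc t → suc t / L ≡ t / L
  /-suc-∤ t L∤1+t with m≤n⇒m<n∨m≡n (m%n<n t L)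
  ... | inj₁ 1+s<L = trans (cong (_/ L) (suc-euclid t)) ([s+q*L]/L≡q (t / L) 1+s<L)
  ... | inj₂ 1+s≡L = ⊥-elim (L∤1+t (divides (suc (t / L)) (trans (suc-euclid t) (cong (_+ t / L * L) 1+s≡L))))

  /-suc-∣ : ∀ t → L ∣ suc t → suc t / L ≡ suc (t / L)
  /-suc-∣ t L∣1+t with m≤n⇒m<n∨m≡n (m%n<n t L)
  ... | inj₁ 1+s<L = ⊥-elim (<⇒≱ 1+s<L (∣⇒≤ (∣m+n∣n⇒∣m (subst (L ∣_) (suc-euclid t) L∣1+t) (n∣m*n (t / L)))))
  ... | inj₂ 1+s≡L = trans (cong (_/ L) (trans (suc-euclid t) (cong (_+ t / L * L) 1+s≡L))) (m*n/n≡m (suc (t / L)) L)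

  skip-suc : ∀ {t} → ¬ L ∣ suc t → skip (suc t) ≡ suc (skip t)
  skip-suc {t} L∤1+t = cong (_+_ (suc t)) (/-suc-∤ t L∤1+t)

  skip-suc-∣ : ∀ {t} → L ∣ suc t → skip (suc t) ≡ 2 + skip t
  skip-suc-∣ {t} L∣1+t = trans (cong (_+_ (suc t)) (/-suc-∣ t L∣1+t)) (cong suc (+-suc t (t / L)))

  skip-mono-≤ : ∀ {t u} → t ≤ u → skip t ≤ skip u
  skip-mono-≤ t≤u = +-mono-≤ t≤u (/-monoˡ-≤ L t≤u)

  skip-cancel-< : ∀ {t u} → skip t < skip u → t < u
  skip-cancel-< skip-t<skip-u = ≰⇒> λ u≤t → <⇒≱ skip-t<skip-u (skip-mono-≤ u≤t)

  suc-skip-not-multiple : ∀ t j → suc (skip t) ≢ j * suc L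
  suc-skip-not-multiple t j eq = <⇒≱ (s≤s (m%n<n t L)) (∣⇒≤ (∣m+n∣n⇒∣m 1+L∣ (n∣m*n (t / L))))
    where
    1+L∣ : suc L ∣ suc (t % L) + t / L * suc L
    1+L∣ = divides j (begin
      suc (t % L) + t / L * suc L      ≡⟨ cong suc (skip-euclid (t / L) (m%n<n t L)) ⟨
      suc (skip (t % L + t / L * L))   ≡⟨ cong (suc ∘′ skip) (m≡m%n+[m/n]*n t L) ⟨
      suc (skip t)                     ≡⟨ eq ⟩
      j * suc L                        ∎)
      where open ≡-Reasoning

  N<[1+N/L]*L : ∀ N → N < suc (N / L) * L
  N<[1+N/L]*L N = subst (_< suc (N / L) * L) (sym (m≡m%n+[m/n]*n N L)) ([e+k*n]<h*n (m%n<n N L) (n<1+n (N / L)))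

  multiple-bound : ∀ N j → j * suc L ≤ N + N / L → j ≤ N / L
  multiple-bound N j bound = ≮⇒≥ λ q<j → <⇒≱ (too-big q<j) bound
    where
    too-big : N / L < j → N + N / L < j * suc L
    too-big q<j = begin-strict
      N + N / L  <⟨ +-mono-< (<-≤-trans (N<[1+N/L]*L N) (*-monoˡ-≤ L q<j)) q<j ⟩
      j * L + j  ≡⟨ +-comm (j * L) j ⟩
      j + j * L  ≡⟨ *-suc j L ⟨
      j * suc L  ∎
      where open ≤-Reasoning

  skip-surjective : ∀ N x → 1 ≤ x → x ≤ N + N / L →
    ¬ (∃ λ j → 1 ≤ j × j ≤ N / L × x ≡ j * suc L) → ∃ λ t → t < N × suc (skip t) ≡ x
  skip-surjective N (suc x) _ x<bound not-multiple with m≤n⇒m<n∨m≡n (s≤s⁻¹ (m%n<n x (suc L)))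
  ... | inj₁ b<L = b + a * L , skip-cancel-< (subst (_≤ N + N / L) (sym eq) x<bound) , eq
    where
    a b : ℕ
    a = x / suc L
    b = x % suc L
    eq : suc (skip (b + a * L)) ≡ suc x
    eq = cong suc (trans (skip-euclid a b<L) (sym (m≡m%n+[m/n]*n x (suc L))))
  ... | inj₂ b≡L = ⊥-elim (not-multiple (suc a , s≤s z≤n , multiple-bound N (suc a) (subst (_≤ N + N / L) eq x<bound) , eq))
    where
    a : ℕ
    a = x / suc L
    eq : suc x ≡ suc a * suc L
    eq = cong suc (trans (m≡m%n+[m/n]*n x (suc L)) (cong (_+ a * suc L) b≡L))

  skip-image : ∀ N x → (∃ λ t → t < N × suc (skip t) ≡ x) ⇔
    ((1 ≤ x × x ≤ N + N / L) × ¬ (∃ λ j → 1 ≤ j × j ≤ N / L × x ≡ j * suc L))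
  skip-image N x = mk⇔ to λ ((1≤x , x≤bound) , not-multiple) → skip-surjective N x 1≤x x≤bound not-multiple
    where
    to : (∃ λ t → t < N × suc (skip t) ≡ x) →
         (1 ≤ x × x ≤ N + N / L) × ¬ (∃ λ j → 1 ≤ j × j ≤ N / L × x ≡ j * suc L)
    to (t , t<N , refl) =
      (s≤s z≤n , +-mono-≤ t<N (/-monoˡ-≤ L (<⇒≤ t<N))) , λ (j , _ , _ , eq) → suc-skip-not-multiple t j eq

-- A value v is entered as ± suc v, so that no entry is 0.
signedColumn : Sign → ℕ → ℕ → Fin 2 → ℤ
signedColumn s m n zero       = s ◃ suc m
signedColumn s m n (suc zero) = Sign.opposite s ◃ suc n

signedColumn-balanced : ∀ s m n → #pos 2 (signedColumn s m n) ≡ #neg 2 (signedColumn s m n)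
signedColumn-balanced Sign.- m n = refl
signedColumn-balanced Sign.+ m n = refl

Σ-signedColumn-top : ∀ s d {n} → Σℤ 2 (signedColumn s (d + n) n) ≡ s ◃ d
Σ-signedColumn-top Sign.+ d {n} = trans (column-top⁺ (+ d) (+ n)) (sym (+◃n≡+n d))
Σ-signedColumn-top Sign.- d {n} = trans (column-top⁻ (+ d) (+ n)) (sym (-◃n≡-n d))

Σ-signedColumn-bottom : ∀ s d {m} → Σℤ 2 (signedColumn s m (d + m)) ≡ Sign.opposite s ◃ d
Σ-signedColumn-bottom Sign.+ d {m} = trans (column-bottom⁺ (+ d) (+ m)) (sym (-◃n≡-n d))
Σ-signedColumn-bottom Sign.- d {m} = trans (column-bottom⁻ (+ d) (+ m)) (sym (+◃n≡+n d))

record Template (b m : ℕ) : Set where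
  field
    signs      : Vec Sign (2 * b)
    top bottom : Vec (Fin m) (2 * b)

open Template

cell : ∀ {b m} → Template b m → Fin 2 → Fin (2 * b) → Fin m
cell T zero       = lookup (top T)
cell T (suc zero) = lookup (bottom T)

block : ∀ {b m} → Template b m → Vec ℕ m → Block 2 (2 * b)
block T X r c = signedColumn (lookup (signs T) c) (lookup X (cell T zero c)) (lookup X (cell T (suc zero) c)) r

∣block∣ : ∀ {b m} (T : Template b m) X r c → ∣ block T X r c ∣ ≡ suc (lookup X (cell T r c))
∣block∣ T X zero       c = abs-◃ (lookup (signs T) c) _
∣block∣ T X (suc zero) c = abs-◃ (Sign.opposite (lookup (signs T) c)) _

Covers : ∀ {b m} → Template b m → Set
Covers T = ∀ e → ∃ λ r → ∃ λ c → cell T r c ≡ e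

covers? : ∀ {b m} (T : Template b m) → Dec (Covers T)
covers? T = all? λ e → any? λ r → any? λ c → cell T r c ≟ e

module ColumnSums {b m} (T : Template b m) (X : Vec ℕ m) where

  ↑ : ∀ c d → lookup X (cell T zero c) ≡ d + lookup X (cell T (suc zero) c) →
      Σℤ 2 (λ r → block T X r c) ≡ lookup (signs T) c ◃ d
  ↑ c d eq rewrite eq = Σ-signedColumn-top (lookup (signs T) c) d

  ↓ : ∀ c d → lookup X (cell T (suc zero) c) ≡ d + lookup X (cell T zero c) →
      Σℤ 2 (λ r → block T X r c) ≡ Sign.opposite (lookup (signs T) c) ◃ d
  ↓ c d eq rewrite eq = Σ-signedColumn-bottom (lookup (signs T) c) d

evenColumn : ∀ {b} → Fin b → Fin (2 * b)
evenColumn i = fromℕ< (*-monoʳ-< 2 (toℕ<n i))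

oddColumn : ∀ {b} → Fin b → Fin (2 * b)
oddColumn {b} i = fromℕ< (subst (_≤ 2 * b) (*-suc 2 (toℕ i)) (*-monoʳ-≤ 2 (toℕ<n i)))

evenColumn-unique : ∀ {b} (i : Fin b) c → toℕ c ≡ 2 * toℕ i → c ≡ evenColumn i
evenColumn-unique i c eq = toℕ-injective (trans eq (sym (toℕ-fromℕ< _)))

oddColumn-unique : ∀ {b} (i : Fin b) c → toℕ c ≡ suc (2 * toℕ i) → c ≡ oddColumn i
oddColumn-unique i c eq = toℕ-injective (trans eq (sym (toℕ-fromℕ< _)))

block-CondC : ∀ {b m} (T : Template b m) (X : Vec ℕ m) (σ : Fin b → ℤ) →
  (∀ r → #pos (2 * b) (block T X r) ≡ #neg (2 * b) (block T X r)) →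
  (∀ r → Σℤ (2 * b) (block T X r) ≡ 0ℤ) →
  (∀ i → Σℤ 2 (λ r → block T X r (evenColumn i)) ≡ σ i) →
  (∀ i → Σℤ 2 (λ r → block T X r (oddColumn i)) ≡ - σ i) →
  CondCBlock b σ (block T X)
block-CondC T X σ rows-balanced row-sums even odd =
  (rows-balanced , λ c → signedColumn-balanced (lookup (signs T) c) _ _) , row-sums , even′ , odd′
  where
  even′ : ∀ i c → toℕ c ≡ 2 * toℕ i → Σℤ 2 (λ r → block T X r c) ≡ σ i
  even′ i c eq rewrite evenColumn-unique i c eq = even i
  odd′ : ∀ i c → toℕ c ≡ suc (2 * toℕ i) → Σℤ 2 (λ r → block T X r c) ≡ - σ i
  odd′ i c eq rewrite oddColumn-unique i c eq = odd i

pairs : ∀ {m} → Vec ℕ m → Vec ℕ (m * 2)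
pairs []       = []
pairs (y ∷ ys) = y ∷ suc y ∷ pairs ys

σ₁₂₂ : Fin 3 → ℤ
σ₁₂₂ = lookup (+ 1 ∷ + 2 ∷ + 2 ∷ [])

σ₁₂₄ : Fin 3 → ℤ
σ₁₂₄ = lookup (+ 1 ∷ + 2 ∷ + 4 ∷ [])

-- A template is filled with pairs (y₀ ∷ … ∷ y₅) whose gaps y_{j+1} - y_j are as its CondC
-- lemma requires; the subscript lists the indices 2(j+1) where a gap 3 may occur (in T₄₈ the
-- gaps there are arbitrary).
T₄₈ : Template 3 12
T₄₈ = record
  { signs  = Sign.+ ∷ Sign.- ∷ Sign.- ∷ Sign.+ ∷ Sign.- ∷ Sign.+ ∷ []
  ; top    = # 1 ∷ # 3 ∷ # 4 ∷ # 5 ∷ # 8 ∷ # 9 ∷ []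
  ; bottom = # 0 ∷ # 2 ∷ # 6 ∷ # 7 ∷ # 10 ∷ # 11 ∷ []
  }

T₄₈-covers : Covers T₄₈
T₄₈-covers = from-yes (covers? T₄₈)

T₄₈-CondC : ∀ {y₀ y₁ y₂ y₃ y₄ y₅} → y₁ ≡ 2 + y₀ → y₃ ≡ 2 + y₂ → y₅ ≡ 2 + y₄ →
            CondCBlock 3 σ₁₂₂ (block T₄₈ (pairs (y₀ ∷ y₁ ∷ y₂ ∷ y₃ ∷ y₄ ∷ y₅ ∷ [])))
T₄₈-CondC {a} {_} {b} {_} {c} refl refl refl = block-CondC T₄₈ X σ₁₂₂
  (λ { zero → refl ; (suc zero) → refl })
  (λ { zero → T₄₈-row₀ (+ a) (+ b) (+ c) ; (suc zero) → T₄₈-row₁ (+ a) (+ b) (+ c) })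
  (λ { zero → ↑ (# 0) 1 refl ; (suc zero) → ↓ (# 2) 2 refl ; (suc (suc zero)) → ↓ (# 4) 2 refl })
  (λ { zero → ↑ (# 1) 1 refl ; (suc zero) → ↓ (# 3) 2 refl ; (suc (suc zero)) → ↓ (# 5) 2 refl })
  where
  X : Vec ℕ 12
  X = pairs (a ∷ 2 + a ∷ b ∷ 2 + b ∷ c ∷ 2 + c ∷ [])
  open ColumnSums T₄₈ X

T₂ : Template 3 12
T₂ = record
  { signs  = Sign.+ ∷ Sign.+ ∷ Sign.- ∷ Sign.- ∷ Sign.- ∷ Sign.+ ∷ []
  ; top    = # 1 ∷ # 6 ∷ # 2 ∷ # 5 ∷ # 8 ∷ # 9 ∷ []
  ; bottom = # 0 ∷ # 7 ∷ # 4 ∷ # 3 ∷ # 10 ∷ # 11 ∷ []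
  }

T₂-covers : Covers T₂
T₂-covers = from-yes (covers? T₂)

T₂-CondC : ∀ {y₀ y₁ y₂ y₃ y₄ y₅} → y₁ ≡ 3 + y₀ → y₂ ≡ 2 + y₁ → y₃ ≡ 2 + y₂ → y₅ ≡ 2 + y₄ →
           CondCBlock 3 σ₁₂₂ (block T₂ (pairs (y₀ ∷ y₁ ∷ y₂ ∷ y₃ ∷ y₄ ∷ y₅ ∷ [])))
T₂-CondC {a} {_} {_} {_} {b} refl refl refl refl = block-CondC T₂ X σ₁₂₂
  (λ { zero → refl ; (suc zero) → refl })
  (λ { zero → T₂-row₀ (+ a) (+ b) ; (suc zero) → T₂-row₁ (+ a) (+ b) })
  (λ { zero → ↑ (# 0) 1 refl ; (suc zero) → ↓ (# 2) 2 refl ; (suc (suc zero)) → ↓ (# 4) 2 refl })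
  (λ { zero → ↓ (# 1) 1 refl ; (suc zero) → ↑ (# 3) 2 refl ; (suc (suc zero)) → ↓ (# 5) 2 refl })
  where
  X : Vec ℕ 12
  X = pairs (a ∷ 3 + a ∷ 5 + a ∷ 7 + a ∷ b ∷ 2 + b ∷ [])
  open ColumnSums T₂ X

T₆ : Template 3 12
T₆ = record
  { signs  = Sign.+ ∷ Sign.+ ∷ Sign.- ∷ Sign.- ∷ Sign.+ ∷ Sign.- ∷ []
  ; top    = # 1 ∷ # 6 ∷ # 2 ∷ # 5 ∷ # 10 ∷ # 11 ∷ []
  ; bottom = # 0 ∷ # 7 ∷ # 4 ∷ # 3 ∷ # 8 ∷ # 9 ∷ []
  }

T₆-covers : Covers T₆
T₆-covers = from-yes (covers? T₆)

T₆-CondC : ∀ {y₀ y₁ y₂ y₃ y₄ y₅} → y₁ ≡ 2 + y₀ → y₂ ≡ 2 + y₁ → y₃ ≡ 3 + y₂ → y₄ ≡ 2 + y₃ → y₅ ≡ 2 + y₄ →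
           CondCBlock 3 σ₁₂₂ (block T₆ (pairs (y₀ ∷ y₁ ∷ y₂ ∷ y₃ ∷ y₄ ∷ y₅ ∷ [])))
T₆-CondC {a} refl refl refl refl refl = block-CondC T₆ X σ₁₂₂
  (λ { zero → refl ; (suc zero) → refl })
  (λ { zero → T₆-row₀ (+ a) ; (suc zero) → T₆-row₁ (+ a) })
  (λ { zero → ↑ (# 0) 1 refl ; (suc zero) → ↓ (# 2) 2 refl ; (suc (suc zero)) → ↑ (# 4) 2 refl })
  (λ { zero → ↓ (# 1) 1 refl ; (suc zero) → ↑ (# 3) 2 refl ; (suc (suc zero)) → ↑ (# 5) 2 refl })
  where
  X : Vec ℕ 12
  X = pairs (a ∷ 2 + a ∷ 4 + a ∷ 7 + a ∷ 9 + a ∷ 11 + a ∷ [])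
  open ColumnSums T₆ X

T₁₀ : Template 3 12
T₁₀ = record
  { signs  = Sign.+ ∷ Sign.+ ∷ Sign.+ ∷ Sign.- ∷ Sign.- ∷ Sign.- ∷ []
  ; top    = # 5 ∷ # 10 ∷ # 2 ∷ # 3 ∷ # 6 ∷ # 9 ∷ []
  ; bottom = # 4 ∷ # 11 ∷ # 0 ∷ # 1 ∷ # 8 ∷ # 7 ∷ []
  }

T₁₀-covers : Covers T₁₀
T₁₀-covers = from-yes (covers? T₁₀)

T₁₀-CondC : ∀ {y₀ y₁ y₂ y₃ y₄ y₅} → y₁ ≡ 2 + y₀ → y₃ ≡ 2 + y₂ → y₄ ≡ 2 + y₃ → y₅ ≡ 3 + y₄ →
            CondCBlock 3 σ₁₂₂ (block T₁₀ (pairs (y₀ ∷ y₁ ∷ y₂ ∷ y₃ ∷ y₄ ∷ y₅ ∷ [])))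
T₁₀-CondC {a} {_} {b} refl refl refl refl = block-CondC T₁₀ X σ₁₂₂
  (λ { zero → refl ; (suc zero) → refl })
  (λ { zero → T₁₀-row₀ (+ a) (+ b) ; (suc zero) → T₁₀-row₁ (+ a) (+ b) })
  (λ { zero → ↑ (# 0) 1 refl ; (suc zero) → ↑ (# 2) 2 refl ; (suc (suc zero)) → ↓ (# 4) 2 refl })
  (λ { zero → ↓ (# 1) 1 refl ; (suc zero) → ↑ (# 3) 2 refl ; (suc (suc zero)) → ↑ (# 5) 2 refl })
  where
  X : Vec ℕ 12
  X = pairs (a ∷ 2 + a ∷ b ∷ 2 + b ∷ 4 + b ∷ 7 + b ∷ [])
  open ColumnSums T₁₀ X

Tₐₗₗ : Template 3 12
Tₐₗₗ = record
  { signs  = Sign.+ ∷ Sign.+ ∷ Sign.- ∷ Sign.- ∷ Sign.- ∷ Sign.+ ∷ []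
  ; top    = # 1 ∷ # 6 ∷ # 3 ∷ # 10 ∷ # 2 ∷ # 8 ∷ []
  ; bottom = # 0 ∷ # 7 ∷ # 4 ∷ # 9 ∷ # 5 ∷ # 11 ∷ []
  }

Tₐₗₗ-covers : Covers Tₐₗₗ
Tₐₗₗ-covers = from-yes (covers? Tₐₗₗ)

Tₐₗₗ-CondC : ∀ {y₀ y₁ y₂ y₃ y₄ y₅} → y₁ ≡ 3 + y₀ → y₂ ≡ 3 + y₁ → y₃ ≡ 3 + y₂ → y₄ ≡ 3 + y₃ → y₅ ≡ 3 + y₄ →
             CondCBlock 3 σ₁₂₄ (block Tₐₗₗ (pairs (y₀ ∷ y₁ ∷ y₂ ∷ y₃ ∷ y₄ ∷ y₅ ∷ [])))
Tₐₗₗ-CondC {a} refl refl refl refl refl = block-CondC Tₐₗₗ X σ₁₂₄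
  (λ { zero → refl ; (suc zero) → refl })
  (λ { zero → Tₐₗₗ-row₀ (+ a) ; (suc zero) → Tₐₗₗ-row₁ (+ a) })
  (λ { zero → ↑ (# 0) 1 refl ; (suc zero) → ↓ (# 2) 2 refl ; (suc (suc zero)) → ↓ (# 4) 4 refl })
  (λ { zero → ↓ (# 1) 1 refl ; (suc zero) → ↑ (# 3) 2 refl ; (suc (suc zero)) → ↓ (# 5) 4 refl })
  where
  X : Vec ℕ 12
  X = pairs (a ∷ 3 + a ∷ 6 + a ∷ 9 + a ∷ 12 + a ∷ 15 + a ∷ [])
  open ColumnSums Tₐₗₗ X

module EvenSkipping (L : ℕ) .{{_ : NonZero L}} (2∣L : 2 ∣ L) where
  open Skipping L

  L∤odd : ∀ {t} → 2 ∣ t → ¬ L ∣ suc t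
  L∤odd 2∣t L∣1+t = from-no (2 ∣? 1) (∣m+n∣n⇒∣m (∣-trans 2∣L L∣1+t) 2∣t)

  skip-next-pair : ∀ {n} → 2 ∣ n → ∀ j → ¬ L ∣ suc j * 2 + n → skip (suc j * 2 + n) ≡ 2 + skip (j * 2 + n)
  skip-next-pair 2∣n j L∤ = trans (skip-suc L∤) (cong suc (skip-suc (L∤odd (∣m∣n⇒∣m+n (n∣m*n j) 2∣n))))

  skip-next-pair-∣ : ∀ {n} → 2 ∣ n → ∀ j → L ∣ suc j * 2 + n → skip (suc j * 2 + n) ≡ 3 + skip (j * 2 + n)
  skip-next-pair-∣ 2∣n j L∣ = trans (skip-suc-∣ L∣) (cong (_+_ 2) (skip-suc (L∤odd (∣m∣n⇒∣m+n (n∣m*n j) 2∣n))))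

  evenSkips : ℕ → (m : ℕ) → Vec ℕ m
  evenSkips t zero    = []
  evenSkips t (suc m) = skip t ∷ evenSkips (2 + t) m

  lookup-pairs-evenSkips : ∀ {t} m → 2 ∣ t → (e : Fin (m * 2)) → lookup (pairs (evenSkips t m)) e ≡ skip (toℕ e + t)
  lookup-pairs-evenSkips (suc m) 2∣t zero             = refl
  lookup-pairs-evenSkips (suc m) 2∣t (suc zero)       = sym (skip-suc (L∤odd 2∣t))
  lookup-pairs-evenSkips {t} (suc m) 2∣t (suc (suc e)) =
    trans (lookup-pairs-evenSkips m (∣m∣n⇒∣m+n ∣-refl 2∣t) e)
          (cong skip (trans (+-suc (toℕ e) (suc t)) (cong suc (+-suc (toℕ e) t))))

  blockValues : ℕ → Vec ℕ 12
  blockValues k = pairs (evenSkips (k * 12) 6)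

  ∣block-values∣ : ∀ (T : Template 3 12) k r c → ∣ block T (blockValues k) r c ∣ ≡ suc (skip (toℕ (cell T r c) + k * 12))
  ∣block-values∣ T k r c = trans (∣block∣ T (blockValues k) r c) (cong suc (lookup-pairs-evenSkips 6 (2∣k*12 k) (cell T r c)))

  blocks : (ℕ → Template 3 12) → (h : ℕ) → Vec (Block 2 6) h
  blocks T h = tabulate λ k → block (T (toℕ k)) (blockValues (toℕ k))

  lookup-blocks : ∀ T h k → lookup (blocks T h) k ≡ block (T (toℕ k)) (blockValues (toℕ k))
  lookup-blocks T h = lookup∘tabulate λ k → block (T (toℕ k)) (blockValues (toℕ k))

  InSupp-blocks : (T : ℕ → Template 3 12) → (∀ k → Covers (T k)) → ∀ h x →
    InSupp (blocks T h) x ⇔ (∃ λ t → t < 12 * h × suc (skip t) ≡ x)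
  InSupp-blocks T covers h x = mk⇔ to from
    where
    entry : ∀ k r c → ∣ lookup (blocks T h) k r c ∣ ≡ suc (skip (toℕ (cell (T (toℕ k)) r c) + toℕ k * 12))
    entry k r c = trans (cong (λ B → ∣ B r c ∣) (lookup-blocks T h k)) (∣block-values∣ (T (toℕ k)) (toℕ k) r c)

    to : InSupp (blocks T h) x → ∃ λ t → t < 12 * h × suc (skip t) ≡ x
    to (k , r , c , eq) = t , subst (t <_) (*-comm h 12) ([e+k*n]<h*n (toℕ<n (cell (T (toℕ k)) r c)) (toℕ<n k))
                            , trans (sym (entry k r c)) eq
      where
      t : ℕ
      t = toℕ (cell (T (toℕ k)) r c) + toℕ k * 12

    from : (∃ λ t → t < 12 * h × suc (skip t) ≡ x) → InSupp (blocks T h) x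
    from (t , t<12h , eq) = let (r , c , cell≡e) = covers (toℕ k) e in k , r , c , located r c cell≡e
      where
      k : Fin h
      k = fromℕ< (m<n*o⇒m/o<n (subst (t <_) (*-comm 12 h) t<12h))
      toℕ-k≡ : toℕ k ≡ t / 12
      toℕ-k≡ = toℕ-fromℕ< _
      e : Fin 12
      e = fromℕ< (m%n<n t 12)
      located : ∀ r c → cell (T (toℕ k)) r c ≡ e → ∣ lookup (blocks T h) k r c ∣ ≡ x
      located r c cell≡e = begin
        ∣ lookup (blocks T h) k r c ∣                         ≡⟨ entry k r c ⟩
        suc (skip (toℕ (cell (T (toℕ k)) r c) + toℕ k * 12))  ≡⟨ cong (suc ∘′ skip) (cong₂ _+_ toℕ-cell≡ (cong (_* 12) toℕ-k≡)) ⟩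
        suc (skip (t % 12 + t / 12 * 12))                     ≡⟨ cong (suc ∘′ skip) (m≡m%n+[m/n]*n t 12) ⟨
        suc (skip t)                                          ≡⟨ eq ⟩
        x                                                     ∎
        where
        open ≡-Reasoning
        toℕ-cell≡ : toℕ (cell (T (toℕ k)) r c) ≡ t % 12
        toℕ-cell≡ = trans (cong toℕ cell≡e) (toℕ-fromℕ< _)

  blocks-correct : (T : ℕ → Template 3 12) → (∀ k → Covers (T k)) → (σ : Fin 3 → ℤ) →
    (∀ k → CondCBlock 3 σ (block (T k) (blockValues k))) → ∀ h →
    Σ (Vec (Block 2 6) h) λ 𝓕 → ConditionC 3 𝓕 ×
      (∀ x → InSupp 𝓕 x ⇔ ((1 ≤ x × x ≤ 12 * h + 12 * h / L) × ¬ (∃ λ j → 1 ≤ j × j ≤ 12 * h / L × x ≡ j * suc L)))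
  blocks-correct T covers σ condC h =
    blocks T h , (σ , λ k → subst (CondCBlock 3 σ) (sym (lookup-blocks T h k)) (condC (toℕ k))) ,
    λ x → skip-image (12 * h) x ⇔-∘ InSupp-blocks T covers h x

module JumpPatterns (L : ℕ) .{{_ : NonZero L}} (2∣L : 2 ∣ L) (2<L : 2 < L) where
  open Skipping L
  open EvenSkipping L 2∣L

  adjacent-jumps : ∀ {m} → L ∣ m → ¬ L ∣ 2 + m
  adjacent-jumps L∣m L∣2+m = <⇒≱ 2<L (∣⇒≤ (∣m+n∣n⇒∣m L∣2+m L∣m))

  distant-jumps : ∀ d {m} → d ∣ 8 → L ∣ m → L ∣ d + m → 4 ∣ m
  distant-jumps d d∣8 L∣m L∣d+m = ∣-trans (∣8⇒4∣ 2<L (∣-trans (∣m+n∣n⇒∣m L∣d+m L∣m) d∣8)) L∣m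

  -- In the first three
  -- cases adjacent-jumps and distant-jumps rule out all other jumps; in the last one jumps
  -- can only occur before n + 4 and n + 8, which T₄₈ tolerates.
  data JumpPattern (n : ℕ) : Set where
    jump-at-2         : L ∣ 2 + n → JumpPattern n
    jump-at-6         : ¬ L ∣ 2 + n → L ∣ 6 + n → JumpPattern n
    jump-at-10        : ¬ L ∣ 2 + n → ¬ L ∣ 6 + n → L ∣ 10 + n → JumpPattern n
    no-jump-at-2-6-10 : ¬ L ∣ 2 + n → ¬ L ∣ 6 + n → ¬ L ∣ 10 + n → JumpPattern n

  jumpPattern : ∀ n → JumpPattern n
  jumpPattern n with L ∣? 2 + n | L ∣? 6 + n | L ∣? 10 + n
  ... | yes L∣2 | _       | _        = jump-at-2 L∣2
  ... | no L∤2  | yes L∣6 | _        = jump-at-6 L∤2 L∣6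
  ... | no L∤2  | no L∤6  | yes L∣10 = jump-at-10 L∤2 L∤6 L∣10
  ... | no L∤2  | no L∤6  | no L∤10  = no-jump-at-2-6-10 L∤2 L∤6 L∤10

  template : ∀ {n} → JumpPattern n → Template 3 12
  template (jump-at-2 _)             = T₂
  template (jump-at-6 _ _)           = T₆
  template (jump-at-10 _ _ _)        = T₁₀
  template (no-jump-at-2-6-10 _ _ _) = T₄₈

  template-covers : ∀ {n} (p : JumpPattern n) → Covers (template p)
  template-covers (jump-at-2 _)             = T₂-covers
  template-covers (jump-at-6 _ _)           = T₆-covers
  template-covers (jump-at-10 _ _ _)        = T₁₀-covers
  template-covers (no-jump-at-2-6-10 _ _ _) = T₄₈-covers

  module _ (k : ℕ) where

    step : ∀ j → ¬ L ∣ suc j * 2 + k * 12 → skip (suc j * 2 + k * 12) ≡ 2 + skip (j * 2 + k * 12)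
    step = skip-next-pair (2∣k*12 k)

    step-∣ : ∀ j → L ∣ suc j * 2 + k * 12 → skip (suc j * 2 + k * 12) ≡ 3 + skip (j * 2 + k * 12)
    step-∣ = skip-next-pair-∣ (2∣k*12 k)

    template-CondC : (p : JumpPattern (k * 12)) → CondCBlock 3 σ₁₂₂ (block (template p) (blockValues k))
    template-CondC (jump-at-2 L∣2) = T₂-CondC (step-∣ 0 L∣2) (step 1 (adjacent-jumps L∣2))
      (step 2 λ L∣6 → 4∣m⇒4∤2+m (4∣k*12 k) (distant-jumps 4 (divides 2 refl) L∣2 L∣6))
      (step 4 λ L∣10 → 4∣m⇒4∤2+m (4∣k*12 k) (distant-jumps 8 ∣-refl L∣2 L∣10))
    template-CondC (jump-at-6 L∤2 L∣6) = T₆-CondC (step 0 L∤2) (step 1 λ L∣4 → adjacent-jumps L∣4 L∣6) (step-∣ 2 L∣6)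
      (step 3 (adjacent-jumps L∣6))
      (step 4 λ L∣10 → 4∣m⇒4∤2+m (∣m∣n⇒∣m+n ∣-refl (4∣k*12 k)) (distant-jumps 4 (divides 2 refl) L∣6 L∣10))
    template-CondC (jump-at-10 L∤2 L∤6 L∣10) =
      T₁₀-CondC (step 0 L∤2) (step 2 L∤6) (step 3 λ L∣8 → adjacent-jumps L∣8 L∣10) (step-∣ 4 L∣10)
    template-CondC (no-jump-at-2-6-10 L∤2 L∤6 L∤10) = T₄₈-CondC (step 0 L∤2) (step 2 L∤6) (step 4 L∤10)

lemma4p5 : (h ρ : ℕ) → 1 ≤ h → 3 ≤ ρ → ρ % 2 ≡ 1 →
    Σ (Vec (Block 2 6) h) λ 𝓕 →
      ConditionC 3 𝓕 ×
      (∀ x → InSupp 𝓕 x ⇔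
        ((1 ≤ x × x ≤ 12 * h + ⌊ (12 * h) / (ρ ∸ 1) ⌋) ×
         ¬ (∃ λ j → 1 ≤ j × j ≤ ⌊ (12 * h) / (ρ ∸ 1) ⌋ × x ≡ j * ρ)))
lemma4p5 h 0 _ () _
lemma4p5 h 1 _ (s≤s ()) _
lemma4p5 h 2 _ (s≤s (s≤s ())) _
lemma4p5 h 4 _ _ ()
lemma4p5 h 3 _ _ _ = blocks-correct (λ _ → Tₐₗₗ) (λ _ → Tₐₗₗ-covers) σ₁₂₄ every-pair-jumps h
  where
  open Skipping 2
  open EvenSkipping 2 ∣-refl
  every-pair-jumps : ∀ k → CondCBlock 3 σ₁₂₄ (block Tₐₗₗ (blockValues k))
  every-pair-jumps k = Tₐₗₗ-CondC (step 0) (step 1) (step 2) (step 3) (step 4)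
    where
    step : ∀ j → skip (suc j * 2 + k * 12) ≡ 3 + skip (j * 2 + k * 12)
    step j = skip-next-pair-∣ (2∣k*12 k) j (∣m∣n⇒∣m+n (n∣m*n (suc j)) (2∣k*12 k))
lemma4p5 h (suc (suc (suc (suc (suc r))))) _ _ ρ-odd =
  blocks-correct (λ k → template (jumps k)) (λ k → template-covers (jumps k)) σ₁₂₂ (λ k → template-CondC k (jumps k)) h
  where
  open JumpPatterns (4 + r) (odd⇒2∣pred (4 + r) ρ-odd) (s≤s (s≤s (s≤s z≤n)))
  open EvenSkipping (4 + r) (odd⇒2∣pred (4 + r) ρ-odd)
  jumps : ∀ k → JumpPattern (k * 12)
  jumps k = jumpPattern (k * 12)
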